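{- Let $G$ be a finite simple graph that is hole-free and paraglider-free, and let $A$ be an induced subgraph of $G$ isomorphic to $\overline{C_6}$. Let $D_1$ be the set of vertices outside $V(A)$ having at least one neighbor in $V(A)$, and for $v\notin V(A)$ let $N_A(v)=N(v)\cap V(A)$. Let $x,y\in D_1$ be nonadjacent and let $P$ be a chordless (induced) path with endpoints $x$ and $y$ none of whose internal vertices belongs to $D_1\cup V(A)$. Then (i) $P$ has exactly three vertices $x,w,y$, and (ii) $N_A(x)$ and $N_A(y)$ are comparable with respect to set inclusion.
   Context: A hole is an induced chordless cycle with at least five vertices. A paraglider is the graph on five vertices $u_1,u_2,w_1,w_2,p$ with edges $u_1u_2$, $u_iw_j$ for $i,j\in\{1,2\}$, $pw_1$, $pw_2$ (the complement of $P_2\cup P_3$). A graph is $H$-free if it has no induced subgraph isomorphic to $H$. $\overline{C_6}$ is the complement of the chordless 6-cycle. -}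

module Defs where

open import Data.Nat using (ℕ; zero; suc; _≡ᵇ_; _≤_; _<_)
open import Data.Fin using (Fin; toℕ; fromℕ)
open import Data.Bool using (Bool; true; false; _∨_; _∧_; not)
open import Data.Product using (Σ; ∃; ∃-syntax; _×_; _,_)
open import Data.Sum using (_⊎_)
open import Relation.Binary.PropositionalEquality using (_≡_; _≢_)
open import Relation.Nullary using (¬_)

record Graph (n : ℕ) : Set where
  field
    adj    : Fin n → Fin n → Bool
    sym    : ∀ u v → adj u v ≡ adj v u
    irrefl : ∀ v → adj v v ≡ false
open Graph public

record InducedCopy {n : ℕ} (G : Graph n) (k : ℕ) (h : Fin k → Fin k → Bool) : Set where
  field
    emb       : Fin k → Fin n
    injective : ∀ i j → emb i ≡ emb j → i ≡ j
    induced   : ∀ i j → i ≢ j → adj G (emb i) (emb j) ≡ h i j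
open InducedCopy public

nextMod : (k : ℕ) → Fin k → Fin k → Bool
nextMod k i j = (toℕ j ≡ᵇ suc (toℕ i)) ∨ ((suc (toℕ i) ≡ᵇ k) ∧ (toℕ j ≡ᵇ 0))

cycleAdj : (k : ℕ) → Fin k → Fin k → Bool
cycleAdj k i j = nextMod k i j ∨ nextMod k j i

-- Complement of C_6 (for distinct vertices).
cobarC6Adj : Fin 6 → Fin 6 → Bool
cobarC6Adj i j = not (cycleAdj 6 i j)

pathAdj : (k : ℕ) → Fin k → Fin k → Bool
pathAdj k i j = (toℕ j ≡ᵇ suc (toℕ i)) ∨ (toℕ i ≡ᵇ suc (toℕ j))

-- Paraglider on Fin 5: u1=0, u2=1, w1=2, w2=3, p=4;
-- edges u1u2, u_i w_j, p w1, p w2.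
paragliderEdge : ℕ → ℕ → Bool
paragliderEdge 0 1 = true
paragliderEdge 0 2 = true
paragliderEdge 0 3 = true
paragliderEdge 1 2 = true
paragliderEdge 1 3 = true
paragliderEdge 2 4 = true
paragliderEdge 3 4 = true
paragliderEdge _ _ = false

paragliderAdj : Fin 5 → Fin 5 → Bool
paragliderAdj i j = paragliderEdge (toℕ i) (toℕ j) ∨ paragliderEdge (toℕ j) (toℕ i)

HoleFree : {n : ℕ} → Graph n → Set
HoleFree G = ∀ k → 5 ≤ k → ¬ InducedCopy G k (cycleAdj k)

ParagliderFree : {n : ℕ} → Graph n → Set
ParagliderFree G = ¬ InducedCopy G 5 paragliderAdj

InV : {n k : ℕ} {G : Graph n} {h : Fin k → Fin k → Bool} → InducedCopy G k h → Fin n → Set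
InV {k = k} A v = ∃[ i ] emb A i ≡ v

InD1 : {n k : ℕ} {G : Graph n} {h : Fin k → Fin k → Bool} → InducedCopy G k h → Fin n → Set
InD1 {G = G} A v = ¬ InV A v × (∃[ i ] adj G v (emb A i) ≡ true)

NA⊆ : {n k : ℕ} {G : Graph n} {h : Fin k → Fin k → Bool} → InducedCopy G k h → Fin n → Fin n → Set
NA⊆ {G = G} A x y = ∀ i → adj G x (emb A i) ≡ true → adj G y (emb A i) ≡ true

module Submission where

-- Write P = x = p₀ … pₘ = y and call a vertex u *detached* if it
-- lies off P and has no neighbour among p₁ … pₘ₋₁; by hypothesis every vertex
-- of A is detached.  Its *trace* records which of the ends x, y it sees.
-- Gluing detached vertices onto P yields induced cycles, forbidden as holes:
-- P + u for u seeing both ends (when m ≥ 3), P + b + a for an edge a–b with a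
-- seeing only x and b only y, and P + b + c + a for an induced path a–c–b
-- where moreover c sees neither end.  In the prism C̅₆ two non-adjacent
-- vertices s, t have their antipodes as non-adjacent common neighbours, so if
-- s sees only x and t only y, both antipodes see x and y.  For m ≥ 3 this
-- gives a hole, so m = 2; and if N_A(x), N_A(y) were incomparable, then x, s,
-- the two antipodes and t would form a paraglider.

open import Defs hiding (sym)
open import Data.Nat using (ℕ; zero; suc; _<_; _≤_; _≡ᵇ_; _≟_; z≤n; s≤s; z<s; s≤s⁻¹)
open import Data.Nat.Properties using (<⇒≢; >⇒≢; ≤∧≢⇒<; ≤-trans; m<n⇒m<1+n; n<1+n)
open import Data.Fin using (Fin; toℕ; fromℕ; inject₁; zero; suc) renaming (_<_ to _<ᶠ_)
open import Data.Fin.Properties using (toℕ-inject₁; toℕ-fromℕ; toℕ<n; toℕ-injective; <-cmp; all?; ¬∀⟶∃¬)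
open import Data.Fin.Relation.Unary.Top using (view; ‵fromℕ; ‵inj₁)
open import Data.Vec using (_∷_; []; lookup)
open import Data.Bool using (Bool; true; false; _∨_)
open import Data.Bool.Properties using (∨-comm; ∨-identityʳ; ∨-zeroʳ; ∧-zeroʳ; ¬-not)
  renaming (_≟_ to _≟ᵇ_)
open import Data.Product using (_×_; _,_; proj₁; proj₂; ∃; map₂)
open import Data.Sum using (_⊎_; inj₁; inj₂)
open import Data.Empty using (⊥; ⊥-elim)
open import Function using (_∘′_; case_of_)
open import Relation.Binary using (tri<; tri≈; tri>)
open import Relation.Binary.PropositionalEquality
  using (_≡_; _≢_; refl; sym; trans; cong; cong₂)
open import Relation.Nullary using (¬_; Dec; yes; no)
open import Relation.Nullary.Decidable using (True; toWitness; dec-true; dec-false; _×-dec_; _→-dec_)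

separated : {A : Set} (f : A → Bool) {a b : A} → f a ≡ true → f b ≡ false → a ≢ b
separated f fa fb refl with () ← trans (sym fa) fb

refute-implication : {a b : Bool} → ¬ (a ≡ true → b ≡ true) → a ≡ true × b ≡ false
refute-implication {true}  {false} _ = refl , refl
refute-implication {false} {_}     h = ⊥-elim (h (λ ()))
refute-implication {_}     {true}  h = ⊥-elim (h (λ _ → refl))

inclusion-or-witness : ∀ {k} (f g : Fin k → Bool) →
  (∀ i → f i ≡ true → g i ≡ true) ⊎ ∃ λ i → f i ≡ true × g i ≡ false
inclusion-or-witness {k} f g = case all? included? of λ where
    (yes f⊆g) → inj₁ f⊆g
    (no f⊈g)  → inj₂ (map₂ refute-implication (¬∀⟶∃¬ k _ included? f⊈g))
  where
  included? : ∀ i → Dec (f i ≡ true → g i ≡ true)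
  included? i = (f i ≟ᵇ true) →-dec (g i ≟ᵇ true)

≡ᵇ-refl : ∀ m → (m ≡ᵇ m) ≡ true
≡ᵇ-refl m = dec-true (m ≟ m) refl

≡ᵇ-false : ∀ {m n} → m ≢ n → (m ≡ᵇ n) ≡ false
≡ᵇ-false {m} {n} = dec-false (m ≟ n)

≡ᵇ-sym : ∀ m n → (m ≡ᵇ n) ≡ (n ≡ᵇ m)
≡ᵇ-sym zero    zero    = refl
≡ᵇ-sym zero    (suc n) = refl
≡ᵇ-sym (suc m) zero    = refl
≡ᵇ-sym (suc m) (suc n) = ≡ᵇ-sym m n

-- "i is one of the two ends 0 and k of a path": the neighbourhood of the
-- vertex that closes that path into a cycle.
isEnd : ℕ → ℕ → Bool
isEnd k i = (i ≡ᵇ 0) ∨ (i ≡ᵇ k)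

isEnd-between : ∀ {k i} → 0 < i → i < k → isEnd k i ≡ false
isEnd-between 0<i i<k rewrite ≡ᵇ-false (>⇒≢ 0<i) | ≡ᵇ-false (<⇒≢ i<k) = refl

isEnd-last : ∀ k → isEnd k k ≡ true
isEnd-last k rewrite ≡ᵇ-refl k = ∨-zeroʳ (k ≡ᵇ 0)

path-sym : ∀ k (i j : Fin k) → pathAdj k i j ≡ pathAdj k j i
path-sym k i j = ∨-comm (toℕ j ≡ᵇ suc (toℕ i)) (toℕ i ≡ᵇ suc (toℕ j))

cycle-sym : ∀ k (i j : Fin k) → cycleAdj k i j ≡ cycleAdj k j i
cycle-sym k i j = ∨-comm (nextMod k i j) (nextMod k j i)

path-restrict : ∀ {k} (i j : Fin k) → pathAdj (suc k) (inject₁ i) (inject₁ j) ≡ pathAdj k i j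
path-restrict i j rewrite toℕ-inject₁ i | toℕ-inject₁ j = refl

path-last : ∀ {k} (j : Fin (suc k)) →
  pathAdj (suc (suc k)) (fromℕ (suc k)) (inject₁ j) ≡ (toℕ j ≡ᵇ k)
path-last {k} j rewrite toℕ-inject₁ j | toℕ-fromℕ k
  | ≡ᵇ-false (<⇒≢ (m<n⇒m<1+n (toℕ<n j))) = ≡ᵇ-sym k (toℕ j)

nextMod-inner : ∀ {k} (i j : Fin (suc k)) →
  nextMod (suc (suc k)) (inject₁ i) (inject₁ j) ≡ (toℕ j ≡ᵇ suc (toℕ i))
nextMod-inner i j rewrite toℕ-inject₁ i | toℕ-inject₁ j | ≡ᵇ-false (<⇒≢ (toℕ<n i)) =
  ∨-identityʳ _

nextMod-wrap : ∀ {k} (j : Fin (suc k)) →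
  nextMod (suc (suc k)) (fromℕ (suc k)) (inject₁ j) ≡ (toℕ j ≡ᵇ 0)
nextMod-wrap {k} j rewrite toℕ-inject₁ j | toℕ-fromℕ k | ≡ᵇ-refl k
  | ≡ᵇ-false (<⇒≢ (m<n⇒m<1+n (toℕ<n j))) = refl

nextMod-toLast : ∀ {k} (j : Fin (suc k)) →
  nextMod (suc (suc k)) (inject₁ j) (fromℕ (suc k)) ≡ (toℕ j ≡ᵇ k)
nextMod-toLast {k} j rewrite toℕ-inject₁ j | toℕ-fromℕ k
  | ∧-zeroʳ (toℕ j ≡ᵇ suc k) | ∨-identityʳ (k ≡ᵇ toℕ j) = ≡ᵇ-sym k (toℕ j)

cycle-restrict : ∀ {k} (i j : Fin (suc k)) →
  cycleAdj (suc (suc k)) (inject₁ i) (inject₁ j) ≡ pathAdj (suc k) i j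
cycle-restrict i j rewrite nextMod-inner i j | nextMod-inner j i = refl

cycle-last : ∀ {k} (j : Fin (suc k)) →
  cycleAdj (suc (suc k)) (fromℕ (suc k)) (inject₁ j) ≡ isEnd k (toℕ j)
cycle-last j rewrite nextMod-wrap j | nextMod-toLast j = refl

snoc : {A : Set} {k : ℕ} → (Fin k → A) → A → Fin (suc k) → A
snoc f z i with view i
... | ‵fromℕ          = z
... | ‵inj₁ {i = j} _ = f j

snoc-elim : {A : Set} {k : ℕ} (f : Fin k → A) (z : A) (R : Fin (suc k) → A → Set) →
  (∀ j → R (inject₁ j) (f j)) → R (fromℕ k) z → ∀ i → R i (snoc f z i)
snoc-elim f z R old new i with view i
... | ‵fromℕ          = new
... | ‵inj₁ {i = j} _ = old j

snoc-fresh : {A : Set} {k : ℕ} (f : Fin k → A) (z w : A) →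
  (∀ j → f j ≢ w) → z ≢ w → ∀ i → snoc f z i ≢ w
snoc-fresh f z w = snoc-elim f z (λ _ v → v ≢ w)

module _ {n : ℕ} (G : Graph n) where

  snoc-profile : {k : ℕ} (f : Fin k → Fin n) (z w : Fin n) (p : ℕ → Bool) →
    (∀ j → adj G w (f j) ≡ p (toℕ j)) → adj G w z ≡ p k →
    ∀ i → adj G w (snoc f z i) ≡ p (toℕ i)
  snoc-profile {k} f z w p old new = snoc-elim f z (λ i v → adj G w v ≡ p (toℕ i))
    (λ j → trans (old j) (cong p (sym (toℕ-inject₁ j))))
    (trans new (cong p (sym (toℕ-fromℕ k))))

  extendCopy : {k : ℕ} {h : Fin k → Fin k → Bool} {h′ : Fin (suc k) → Fin (suc k) → Bool} →
    (∀ i j → h′ i j ≡ h′ j i) → (∀ i j → h′ (inject₁ i) (inject₁ j) ≡ h i j) →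
    (Q : InducedCopy G k h) (z : Fin n) → (∀ j → emb Q j ≢ z) →
    (∀ j → adj G z (emb Q j) ≡ h′ (fromℕ k) (inject₁ j)) → InducedCopy G (suc k) h′
  extendCopy {k} {h} {h′} h′-sym h′-restrict Q z fresh z-sees = record
    { emb = e ; injective = inj ; induced = ind }
    where
    e : Fin (suc k) → Fin n
    e = snoc (emb Q) z
    inj : ∀ i j → e i ≡ e j → i ≡ j
    inj i j eq with view i | view j
    ... | ‵fromℕ          | ‵fromℕ          = refl
    ... | ‵fromℕ          | ‵inj₁ {i = b} _ = ⊥-elim (fresh b (sym eq))
    ... | ‵inj₁ {i = a} _ | ‵fromℕ          = ⊥-elim (fresh a eq)
    ... | ‵inj₁ {i = a} _ | ‵inj₁ {i = b} _ = cong inject₁ (injective Q a b eq)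
    ind : ∀ i j → i ≢ j → adj G (e i) (e j) ≡ h′ i j
    ind i j i≢j with view i | view j
    ... | ‵fromℕ          | ‵fromℕ          = ⊥-elim (i≢j refl)
    ... | ‵fromℕ          | ‵inj₁ {i = b} _ = z-sees b
    ... | ‵inj₁ {i = a} _ | ‵fromℕ          =
      trans (Graph.sym G (emb Q a) z) (trans (z-sees a) (h′-sym (fromℕ k) (inject₁ a)))
    ... | ‵inj₁ {i = a} _ | ‵inj₁ {i = b} _ =
      trans (induced Q a b (λ a≡b → i≢j (cong inject₁ a≡b))) (sym (h′-restrict a b))

  extendPath : {k : ℕ} (Q : InducedCopy G (suc k) (pathAdj (suc k))) (z : Fin n) →
    (∀ j → emb Q j ≢ z) → (∀ j → adj G z (emb Q j) ≡ (toℕ j ≡ᵇ k)) →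
    InducedCopy G (suc (suc k)) (pathAdj (suc (suc k)))
  extendPath Q z fresh z-sees =
    extendCopy (path-sym _) path-restrict Q z fresh (λ j → trans (z-sees j) (sym (path-last j)))

  closeCycle : {k : ℕ} (Q : InducedCopy G (suc k) (pathAdj (suc k))) (z : Fin n) →
    (∀ j → emb Q j ≢ z) → (∀ j → adj G z (emb Q j) ≡ isEnd k (toℕ j)) →
    InducedCopy G (suc (suc k)) (cycleAdj (suc (suc k)))
  closeCycle Q z fresh z-sees =
    extendCopy (cycle-sym _) cycle-restrict Q z fresh (λ j → trans (z-sees j) (sym (cycle-last j)))

  adjacent-distinct : ∀ {u v} → adj G u v ≡ true → u ≢ v
  adjacent-distinct {u} u~v refl with () ← trans (sym u~v) (irrefl G u)

  copy-from-pairs : {k : ℕ} {h : Fin k → Fin k → Bool} → (∀ i j → h i j ≡ h j i) →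
    (e : Fin k → Fin n) → (∀ i j → i <ᶠ j → e i ≢ e j × adj G (e i) (e j) ≡ h i j) →
    InducedCopy G k h
  copy-from-pairs {k} {h} h-sym e pair = record { emb = e ; injective = inj ; induced = ind }
    where
    inj : ∀ i j → e i ≡ e j → i ≡ j
    inj i j eq with <-cmp i j
    ... | tri< i<j _ _ = ⊥-elim (proj₁ (pair i j i<j) eq)
    ... | tri≈ _ i≡j _ = i≡j
    ... | tri> _ _ j<i = ⊥-elim (proj₁ (pair j i j<i) (sym eq))
    ind : ∀ i j → i ≢ j → adj G (e i) (e j) ≡ h i j
    ind i j i≢j with <-cmp i j
    ... | tri< i<j _ _ = proj₂ (pair i j i<j)
    ... | tri≈ _ i≡j _ = ⊥-elim (i≢j i≡j)
    ... | tri> _ _ j<i =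
      trans (Graph.sym G (e i) (e j)) (trans (proj₂ (pair j i j<i)) (h-sym j i))

  paraglider-sym : ∀ i j → paragliderAdj i j ≡ paragliderAdj j i
  paraglider-sym i j =
    ∨-comm (paragliderEdge (toℕ i) (toℕ j)) (paragliderEdge (toℕ j) (toℕ i))

  -- Seven edges and three non-edges among u₁, u₂, w₁, w₂, p form a paraglider;
  -- the twins w₁, w₂ are the only pair whose distinctness is not forced.
  paraglider : (u₁ u₂ w₁ w₂ p : Fin n) → w₁ ≢ w₂ →
    adj G u₁ u₂ ≡ true → adj G u₁ w₁ ≡ true → adj G u₁ w₂ ≡ true →
    adj G u₂ w₁ ≡ true → adj G u₂ w₂ ≡ true → adj G w₁ p ≡ true → adj G w₂ p ≡ true →
    adj G u₁ p ≡ false → adj G u₂ p ≡ false → adj G w₁ w₂ ≡ false →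
    InducedCopy G 5 paragliderAdj
  paraglider u₁ u₂ w₁ w₂ p w₁≢w₂ u₁u₂ u₁w₁ u₁w₂ u₂w₁ u₂w₂ w₁p w₂p u₁≁p u₂≁p w₁≁w₂ =
    copy-from-pairs paraglider-sym vertex pair
    where
    vertex : Fin 5 → Fin n
    vertex = lookup (u₁ ∷ u₂ ∷ w₁ ∷ w₂ ∷ p ∷ [])
    edge : ∀ {u v} → adj G u v ≡ true → u ≢ v × adj G u v ≡ true
    edge u~v = adjacent-distinct u~v , u~v
    pair : ∀ i j → i <ᶠ j → vertex i ≢ vertex j × adj G (vertex i) (vertex j) ≡ paragliderAdj i j
    pair zero (suc zero)                         _ = edge u₁u₂
    pair zero (suc (suc zero))                   _ = edge u₁w₁
    pair zero (suc (suc (suc zero)))             _ = edge u₁w₂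
    pair zero (suc (suc (suc (suc zero))))       _ =
      separated (adj G u₂) (trans (Graph.sym G u₂ u₁) u₁u₂) u₂≁p , u₁≁p
    pair (suc zero) (suc (suc zero))             _ = edge u₂w₁
    pair (suc zero) (suc (suc (suc zero)))       _ = edge u₂w₂
    pair (suc zero) (suc (suc (suc (suc zero)))) _ = separated (adj G u₁) u₁u₂ u₁≁p , u₂≁p
    pair (suc (suc zero)) (suc (suc (suc zero))) _ = w₁≢w₂ , w₁≁w₂
    pair (suc (suc zero)) (suc (suc (suc (suc zero))))       _ = edge w₁p
    pair (suc (suc (suc zero))) (suc (suc (suc (suc zero)))) _ = edge w₂p
    pair i zero ()
    pair (suc i) (suc zero) (s≤s ())
    pair (suc (suc i)) (suc (suc zero)) (s≤s (s≤s ()))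
    pair (suc (suc (suc i))) (suc (suc (suc zero))) (s≤s (s≤s (s≤s ())))
    pair (suc (suc (suc (suc i)))) (suc (suc (suc (suc zero)))) (s≤s (s≤s (s≤s (s≤s ()))))

path-length≥2 : ∀ {n} (G : Graph n) {m} (P : InducedCopy G (suc m) (pathAdj (suc m))) →
  emb P zero ≢ emb P (fromℕ m) → adj G (emb P zero) (emb P (fromℕ m)) ≡ false → 2 ≤ m
path-length≥2 G {zero}        P x≢y _   = ⊥-elim (x≢y refl)
path-length≥2 G {suc zero}    P _   x≁y with () ← trans (sym x≁y) (induced P zero (suc zero) (λ ()))
path-length≥2 G {suc (suc m)} P _   _   = s≤s (s≤s z≤n)

module AlongPath {n : ℕ} (G : Graph n) {m : ℕ} (P : InducedCopy G (suc m) (pathAdj (suc m))) where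

  x y : Fin n
  x = emb P zero
  y = emb P (fromℕ m)

  position : (j : Fin (suc m)) → j ≡ zero ⊎ j ≡ fromℕ m ⊎ (0 < toℕ j × toℕ j < m)
  position zero = inj₁ refl
  position (suc j) with toℕ (suc j) ≟ m
  ... | yes j≡m = inj₂ (inj₁ (toℕ-injective (trans j≡m (sym (toℕ-fromℕ m)))))
  ... | no  j≢m = inj₂ (inj₂ (z<s , ≤∧≢⇒< (s≤s⁻¹ (toℕ<n (suc j))) j≢m))

  record Detached (u : Fin n) : Set where
    field
      off-path : ∀ j → emb P j ≢ u
      silent   : ∀ j → 0 < toℕ j → toℕ j < m → adj G u (emb P j) ≡ false
  open Detached

  trace : Fin n → Bool × Bool
  trace u = adj G x u , adj G y u

  detached-from-D₁ : {k : ℕ} {h : Fin k → Fin k → Bool} (A : InducedCopy G k h) →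
    ¬ InV A x → ¬ InV A y →
    (∀ j → 0 < toℕ j → toℕ j < m → ¬ InD1 A (emb P j) × ¬ InV A (emb P j)) →
    ∀ a → Detached (emb A a)
  detached-from-D₁ A x∉A y∉A interior a = record { off-path = off ; silent = quiet }
    where
    off : ∀ j → emb P j ≢ emb A a
    off j eq with position j
    ... | inj₁ refl               = x∉A (a , sym eq)
    ... | inj₂ (inj₁ refl)        = y∉A (a , sym eq)
    ... | inj₂ (inj₂ (0<j , j<m)) = proj₂ (interior j 0<j j<m) (a , sym eq)
    quiet : ∀ j → 0 < toℕ j → toℕ j < m → adj G (emb A a) (emb P j) ≡ false
    quiet j 0<j j<m = ¬-not λ a~j → proj₁ (interior j 0<j j<m)
      (proj₂ (interior j 0<j j<m) , a , trans (Graph.sym G (emb P j) (emb A a)) a~j)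

  profile : ∀ {u} → Detached u → (p : ℕ → Bool) → adj G x u ≡ p 0 → adj G y u ≡ p m →
    (∀ i → 0 < i → i < m → p i ≡ false) → ∀ j → adj G u (emb P j) ≡ p (toℕ j)
  profile {u} d p at-x at-y inside j with position j
  ... | inj₁ refl               = trans (Graph.sym G u x) at-x
  ... | inj₂ (inj₁ refl)        =
    trans (Graph.sym G u y) (trans at-y (cong p (sym (toℕ-fromℕ m))))
  ... | inj₂ (inj₂ (0<j , j<m)) = trans (silent d j 0<j j<m) (sym (inside (toℕ j) 0<j j<m))

  y-only-profile : 0 < m → ∀ {b} → Detached b → trace b ≡ (false , true) →
    ∀ j → adj G b (emb P j) ≡ (toℕ j ≡ᵇ m)
  y-only-profile 0<m db tb = profile db (_≡ᵇ m)
    (trans (cong proj₁ tb) (sym (≡ᵇ-false (<⇒≢ 0<m))))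
    (trans (cong proj₂ tb) (sym (≡ᵇ-refl m)))
    (λ i _ i<m → ≡ᵇ-false (<⇒≢ i<m))

  module _ (hole-free : HoleFree G) where

    -- P + u is a hole of length m + 2.
    long-path-common-neighbour : 3 ≤ m → ∀ {u} → Detached u → trace u ≡ (true , true) → ⊥
    long-path-common-neighbour m≥3 {u} d tu =
      hole-free (suc (suc m)) (s≤s (s≤s m≥3)) (closeCycle G P u (off-path d) u-sees-P)
      where
      u-sees-P : ∀ j → adj G u (emb P j) ≡ isEnd m (toℕ j)
      u-sees-P = profile d (isEnd m) (cong proj₁ tu) (trans (cong proj₂ tu) (sym (isEnd-last m)))
        (λ i → isEnd-between)

    -- P + b + a is a hole of length m + 3.
    path-edge-hole : 2 ≤ m → ∀ {a b} → Detached a → Detached b →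
      trace a ≡ (true , false) → trace b ≡ (false , true) → adj G a b ≡ true → ⊥
    path-edge-hole m≥2 {a} {b} da db ta tb a~b =
      hole-free (suc (suc (suc m))) (s≤s (s≤s (s≤s m≥2))) (closeCycle G Q a a-fresh a-sees-Q)
      where
      0<m : 0 < m
      0<m = ≤-trans (s≤s z≤n) m≥2
      b≢a : b ≢ a
      b≢a = separated (adj G x) (cong proj₁ ta) (cong proj₁ tb) ∘′ sym
      Q : InducedCopy G (suc (suc m)) (pathAdj (suc (suc m)))
      Q = extendPath G P b (off-path db) (y-only-profile 0<m db tb)
      a-fresh : ∀ j → emb Q j ≢ a
      a-fresh = snoc-fresh (emb P) b a (off-path da) b≢a
      a-sees-Q : ∀ j → adj G a (emb Q j) ≡ isEnd (suc m) (toℕ j)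
      a-sees-Q = snoc-profile G (emb P) b a (isEnd (suc m))
        (profile da (isEnd (suc m)) (cong proj₁ ta)
          (trans (cong proj₂ ta) (sym (isEnd-between 0<m (n<1+n m))))
          (λ i 0<i i<m → isEnd-between 0<i (m<n⇒m<1+n i<m)))
        (trans a~b (sym (isEnd-last (suc m))))

    -- P + b + c + a is a hole of length m + 4.
    path-detour-hole : 1 ≤ m → ∀ {a b c} → Detached a → Detached b → Detached c →
      trace a ≡ (true , false) → trace b ≡ (false , true) → trace c ≡ (false , false) →
      adj G a c ≡ true → adj G c b ≡ true → adj G a b ≡ false → ⊥
    path-detour-hole m≥1 {a} {b} {c} da db dc ta tb tc a~c c~b a≁b =
      hole-free (suc (suc (suc (suc m)))) (s≤s (s≤s (s≤s (s≤s m≥1))))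
        (closeCycle G Q₂ a a-fresh a-sees-Q₂)
      where
      b≢a : b ≢ a
      b≢a = separated (adj G x) (cong proj₁ ta) (cong proj₁ tb) ∘′ sym
      b≢c : b ≢ c
      b≢c = separated (adj G y) (cong proj₂ tb) (cong proj₂ tc)
      c≢a : c ≢ a
      c≢a = separated (adj G x) (cong proj₁ ta) (cong proj₁ tc) ∘′ sym
      Q₁ : InducedCopy G (suc (suc m)) (pathAdj (suc (suc m)))
      Q₁ = extendPath G P b (off-path db) (y-only-profile m≥1 db tb)
      c-sees-Q₁ : ∀ j → adj G c (emb Q₁ j) ≡ (toℕ j ≡ᵇ suc m)
      c-sees-Q₁ = snoc-profile G (emb P) b c (_≡ᵇ suc m)
        (profile dc (_≡ᵇ suc m) (cong proj₁ tc)
          (trans (cong proj₂ tc) (sym (≡ᵇ-false (<⇒≢ (n<1+n m)))))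
          (λ i _ i<m → ≡ᵇ-false (<⇒≢ (m<n⇒m<1+n i<m))))
        (trans c~b (sym (≡ᵇ-refl m)))
      Q₂ : InducedCopy G (suc (suc (suc m))) (pathAdj (suc (suc (suc m))))
      Q₂ = extendPath G Q₁ c (snoc-fresh (emb P) b c (off-path dc) b≢c) c-sees-Q₁
      a-fresh : ∀ j → emb Q₂ j ≢ a
      a-fresh = snoc-fresh (emb Q₁) c a (snoc-fresh (emb P) b a (off-path da) b≢a) c≢a
      a-sees-Q₂ : ∀ j → adj G a (emb Q₂ j) ≡ isEnd (suc (suc m)) (toℕ j)
      a-sees-Q₂ = snoc-profile G (emb Q₁) c a (isEnd (suc (suc m)))
        (snoc-profile G (emb P) b a (isEnd (suc (suc m)))
          (profile da (isEnd (suc (suc m))) (cong proj₁ ta)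
            (trans (cong proj₂ ta) (sym (isEnd-between m≥1 (m<n⇒m<1+n (n<1+n m)))))
            (λ i 0<i i<m → isEnd-between 0<i (m<n⇒m<1+n (m<n⇒m<1+n i<m))))
          (trans a≁b (sym (isEnd-between z<s (n<1+n (suc m))))))
        (trans a~c (sym (isEnd-last (suc (suc m)))))

by-inspection : {P : Fin 6 → Fin 6 → Set} (P? : ∀ s t → Dec (P s t)) →
  {True (all? λ s → all? (P? s))} → ∀ s t → P s t
by-inspection P? {ok} = toWitness ok

cobar-refl : ∀ a → cobarC6Adj a a ≡ true
cobar-refl zero                                = refl
cobar-refl (suc zero)                          = refl
cobar-refl (suc (suc zero))                    = refl
cobar-refl (suc (suc (suc zero)))              = refl
cobar-refl (suc (suc (suc (suc zero))))        = refl
cobar-refl (suc (suc (suc (suc (suc zero)))))  = refl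

opposite : Fin 6 → Fin 6
opposite zero                               = suc (suc (suc zero))
opposite (suc zero)                         = suc (suc (suc (suc zero)))
opposite (suc (suc zero))                   = suc (suc (suc (suc (suc zero))))
opposite (suc (suc (suc zero)))             = zero
opposite (suc (suc (suc (suc zero))))       = suc zero
opposite (suc (suc (suc (suc (suc zero))))) = suc (suc zero)

CommonNeighbour : Fin 6 → Fin 6 → Fin 6 → Set
CommonNeighbour s t c = cobarC6Adj s c ≡ true × cobarC6Adj c t ≡ true

common? : ∀ s t c → Dec (CommonNeighbour s t c)
common? s t c = (cobarC6Adj s c ≟ᵇ true) ×-dec (cobarC6Adj c t ≟ᵇ true)

antipodes : ∀ s t → cobarC6Adj s t ≡ false →
  CommonNeighbour s t (opposite s) × CommonNeighbour s t (opposite t) ×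
  cobarC6Adj (opposite s) (opposite t) ≡ false
antipodes = by-inspection λ s t → (cobarC6Adj s t ≟ᵇ false) →-dec
  (common? s t (opposite s) ×-dec common? s t (opposite t) ×-dec
   (cobarC6Adj (opposite s) (opposite t) ≟ᵇ false))

common-neighbour-distinct : ∀ {s t c} → cobarC6Adj s t ≡ false → CommonNeighbour s t c →
  s ≢ c × c ≢ t
common-neighbour-distinct {s} {t} s≁t (s~c , c~t) =
  separated (λ v → cobarC6Adj v t) c~t s≁t ∘′ sym , separated (cobarC6Adj s) s~c s≁t

module DetachedCoC6 {n : ℕ} (G : Graph n) (hole-free : HoleFree G)
    (A : InducedCopy G 6 cobarC6Adj) {m : ℕ} (P : InducedCopy G (suc m) (pathAdj (suc m)))
    (m≥2 : 2 ≤ m) (detached : ∀ a → AlongPath.Detached G P (emb A a)) where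

  open AlongPath G P

  v : Fin 6 → Fin n
  v = emb A

  edge : ∀ {a b} → a ≢ b → cobarC6Adj a b ≡ true → adj G (v a) (v b) ≡ true
  edge a≢b a~b = trans (induced A _ _ a≢b) a~b

  non-edge : ∀ {a b} → cobarC6Adj a b ≡ false → adj G (v a) (v b) ≡ false
  non-edge {a} a≁b = trans (induced A _ _ (separated (cobarC6Adj a) (cobar-refl a) a≁b)) a≁b

  one-sided-non-adjacent : ∀ {s t} → trace (v s) ≡ (true , false) → trace (v t) ≡ (false , true) →
    cobarC6Adj s t ≡ false
  one-sided-non-adjacent {s} {t} ts tt with cobarC6Adj s t in s~t
  ... | false = refl
  ... | true  = ⊥-elim (path-edge-hole hole-free m≥2 (detached s) (detached t) ts tt
    (edge (separated (λ a → adj G x (v a)) (cong proj₁ ts) (cong proj₁ tt)) s~t))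

  common-neighbour-sees-both : ∀ {s t c} → trace (v s) ≡ (true , false) →
    trace (v t) ≡ (false , true) → CommonNeighbour s t c → trace (v c) ≡ (true , true)
  common-neighbour-sees-both {s} {t} {c} ts tt (s~c , c~t) = classify (trace (v c)) refl
    where
    s≁t : cobarC6Adj s t ≡ false
    s≁t = one-sided-non-adjacent ts tt
    distinct : s ≢ c × c ≢ t
    distinct = common-neighbour-distinct s≁t (s~c , c~t)
    classify : ∀ τ → trace (v c) ≡ τ → trace (v c) ≡ (true , true)
    classify (true , true)   tc = tc
    classify (true , false)  tc = ⊥-elim (path-edge-hole hole-free m≥2 (detached c) (detached t)
      tc tt (edge (proj₂ distinct) c~t))
    classify (false , true)  tc = ⊥-elim (path-edge-hole hole-free m≥2 (detached s) (detached c)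
      ts tc (edge (proj₁ distinct) s~c))
    classify (false , false) tc = ⊥-elim (path-detour-hole hole-free (≤-trans (s≤s z≤n) m≥2)
      (detached s) (detached t) (detached c) ts tt tc
      (edge (proj₁ distinct) s~c) (edge (proj₂ distinct) c~t) (non-edge s≁t))

  length-two : (∃ λ a → adj G x (v a) ≡ true) → (∃ λ b → adj G y (v b) ≡ true) → m ≡ 2
  length-two (s , x~s) (t , y~t) with m ≟ 2
  ... | yes m≡2 = m≡2
  ... | no  m≢2 = ⊥-elim (long-path-common-neighbour hole-free m≥3 (detached (opposite s))
      (common-neighbour-sees-both ts tt (proj₁ (antipodes s t (one-sided-non-adjacent ts tt)))))
    where
    m≥3 : 3 ≤ m
    m≥3 = ≤∧≢⇒< m≥2 (m≢2 ∘′ sym)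
    ts : trace (v s) ≡ (true , false)
    ts = cong₂ _,_ x~s (¬-not λ y~s →
      long-path-common-neighbour hole-free m≥3 (detached s) (cong₂ _,_ x~s y~s))
    tt : trace (v t) ≡ (false , true)
    tt = cong₂ _,_ (¬-not λ x~t →
      long-path-common-neighbour hole-free m≥3 (detached t) (cong₂ _,_ x~t y~t)) y~t

  -- Part (ii): otherwise x, s, the two antipodes and t form a paraglider.
  comparable : ParagliderFree G → NA⊆ A x y ⊎ NA⊆ A y x
  comparable paraglider-free
    with inclusion-or-witness (λ a → adj G x (v a)) (λ a → adj G y (v a))
       | inclusion-or-witness (λ a → adj G y (v a)) (λ a → adj G x (v a))
  ... | inj₁ x⊆y | _        = inj₁ x⊆y
  ... | inj₂ _   | inj₁ y⊆x = inj₂ y⊆x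
  ... | inj₂ (s , x~s , y≁s) | inj₂ (t , y~t , x≁t) = ⊥-elim (paraglider-free
      (paraglider G x (v s) (v c₁) (v c₂) (v t) (c₁≢c₂ ∘′ injective A c₁ c₂) x~s
        (cong proj₁ tc₁) (cong proj₁ tc₂)
        (edge (proj₁ distinct₁) (proj₁ s-c₁-t)) (edge (proj₁ distinct₂) (proj₁ s-c₂-t))
        (edge (proj₂ distinct₁) (proj₂ s-c₁-t)) (edge (proj₂ distinct₂) (proj₂ s-c₂-t))
        x≁t (non-edge s≁t) (non-edge c₁≁c₂)))
    where
    ts : trace (v s) ≡ (true , false)
    ts = cong₂ _,_ x~s y≁s
    tt : trace (v t) ≡ (false , true)
    tt = cong₂ _,_ x≁t y~t
    s≁t : cobarC6Adj s t ≡ false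
    s≁t = one-sided-non-adjacent ts tt
    c₁ c₂ : Fin 6
    c₁ = opposite s
    c₂ = opposite t
    s-c₁-t : CommonNeighbour s t c₁
    s-c₁-t = proj₁ (antipodes s t s≁t)
    s-c₂-t : CommonNeighbour s t c₂
    s-c₂-t = proj₁ (proj₂ (antipodes s t s≁t))
    distinct₁ : s ≢ c₁ × c₁ ≢ t
    distinct₁ = common-neighbour-distinct s≁t s-c₁-t
    distinct₂ : s ≢ c₂ × c₂ ≢ t
    distinct₂ = common-neighbour-distinct s≁t s-c₂-t
    c₁≁c₂ : cobarC6Adj c₁ c₂ ≡ false
    c₁≁c₂ = proj₂ (proj₂ (antipodes s t s≁t))
    c₁≢c₂ : c₁ ≢ c₂
    c₁≢c₂ = separated (cobarC6Adj c₁) (cobar-refl c₁) c₁≁c₂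
    tc₁ : trace (v c₁) ≡ (true , true)
    tc₁ = common-neighbour-sees-both ts tt s-c₁-t
    tc₂ : trace (v c₂) ≡ (true , true)
    tc₂ = common-neighbour-sees-both ts tt s-c₂-t

proposition6 : {n : ℕ} (G : Graph n) → HoleFree G → ParagliderFree G →
    (A : InducedCopy G 6 cobarC6Adj) →
    (x y : Fin n) → InD1 A x → InD1 A y → x ≢ y → adj G x y ≡ false →
    (m : ℕ) (P : InducedCopy G (suc m) (pathAdj (suc m))) →
    emb P zero ≡ x → emb P (fromℕ m) ≡ y →
    (∀ i → 0 < toℕ i → toℕ i < m → ¬ InD1 A (emb P i) × ¬ InV A (emb P i)) →
    (m ≡ 2) × (NA⊆ A x y ⊎ NA⊆ A y x)
proposition6 G hole-free paraglider-free A x y x∈D₁ y∈D₁ x≢y x≁y m P refl refl interior =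
  length-two (proj₂ x∈D₁) (proj₂ y∈D₁) , comparable paraglider-free
  where
  open DetachedCoC6 G hole-free A P (path-length≥2 G P x≢y x≁y)
    (AlongPath.detached-from-D₁ G P A (proj₁ x∈D₁) (proj₁ y∈D₁) interior)
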